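{- Let $(G,c,k)$ be an instance of \textsc{Multi-STC} where $c\ge 4$ is even, and let $A\subseteq\mathscr{P}$ be a periphery component with $A^*=\emptyset$. Then $(G,c,k)$ is a yes-instance if and only if the instance obtained by deleting all vertices of $A$ from $G$ (with the same $c$ and $k$) is a yes-instance.
   Context: A $c$-colored labeling of $G=(V,E)$ is a partition $L=(S^1_L,\dots,S^c_L,W_L)$ of $E$; it is an STC-labeling if there are no $\{u,v\},\{v,w\}\in S^i_L$ ($u\ne w$) with $\{u,w\}\notin E$. \textsc{Multi-STC}: given $G$ and $c,k$, decide whether $G$ has a $c$-colored STC-labeling with $|W_L|\le k$. Fix $D\subseteq E$ such that $(V,E\setminus D)$ has maximum degree at most $\lfloor c/2\rfloor+1$; the core $\mathscr{C}$ is the set of vertices incident with an edge of $D$, the periphery is $\mathscr{P}=V\setminus\mathscr{C}$, a periphery component is the vertex set of a connected component of $G[\mathscr{P}]$, and for a periphery component $A$, $A^*:=N(\mathscr{C})\cap A$ is its set of close vertices. -}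

module Defs where

open import Data.Nat using (ℕ; zero; suc; _+_; _≤_; _<_; _<ᵇ_)
open import Data.Nat.DivMod using (_/_)
open import Data.Bool using (Bool; true; false; _∧_; not; if_then_else_)
open import Data.Fin using (Fin; toℕ)
open import Data.List using (List; []; _∷_; map; concatMap; allFin)
open import Data.Nat.ListAction using (sum)
open import Data.Product using (Σ; ∃; _×_; _,_)
open import Relation.Binary.PropositionalEquality using (_≡_; _≢_)
open import Relation.Nullary using (¬_)

record Graph (n : ℕ) : Set where
  field
    adj     : Fin n → Fin n → Bool
    adj-sym : ∀ u v → adj u v ≡ adj v u
    adj-irr : ∀ v → adj v v ≡ false
open Graph public

data Label (c : ℕ) : Set where
  strong : Fin c → Label c
  weak   : Label c

isWeak : ∀ {c} → Label c → Bool
isWeak (strong _) = false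
isWeak weak       = true

-- A labeling assigns a label to every (ordered) pair; only the values on
-- edges matter, and they must not depend on the orientation, so that the
-- labeling is a partition (S^1,...,S^c,W) of E.
Labeling : ℕ → ℕ → Set
Labeling n c = Fin n → Fin n → Label c

IsLabelingOf : ∀ {n c} → Graph n → Labeling n c → Set
IsLabelingOf G L = ∀ u v → adj G u v ≡ true → L u v ≡ L v u

IsSTC : ∀ {n c} → Graph n → Labeling n c → Set
IsSTC {n} {c} G L =
  ∀ (u v w : Fin n) (i : Fin c) → u ≢ w →
  adj G u v ≡ true → adj G v w ≡ true →
  L u v ≡ strong i → L v w ≡ strong i →
  adj G u w ≡ true

boolℕ : Bool → ℕ
boolℕ true  = 1
boolℕ false = 0

countFin : ∀ {n} → (Fin n → Bool) → ℕ
countFin {n} P = sum (map (λ v → boolℕ (P v)) (allFin n))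

weakCount : ∀ {n c} → Graph n → Labeling n c → ℕ
weakCount {n} G L =
  sum (concatMap (λ u → map (λ v →
        boolℕ ((toℕ u <ᵇ toℕ v) ∧ (adj G u v ∧ isWeak (L u v))))
      (allFin n)) (allFin n))

YesInstance : ∀ {n} → Graph n → ℕ → ℕ → Set
YesInstance {n} G c k =
  Σ (Labeling n c) λ L → IsLabelingOf G L × IsSTC G L × (weakCount G L ≤ k)

record Deletion {n : ℕ} (G : Graph n) (c : ℕ) : Set where
  field
    D       : Fin n → Fin n → Bool
    D-sym   : ∀ u v → D u v ≡ D v u
    D⊆E     : ∀ u v → D u v ≡ true → adj G u v ≡ true
    maxDeg  : ∀ v → countFin (λ w → adj G v w ∧ not (D v w)) ≤ c / 2 + 1
open Deletion public

InCore : ∀ {n} {G : Graph n} {c} → Deletion G c → Fin n → Set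
InCore {n} Δ v = ∃ λ (w : Fin n) → D Δ v w ≡ true

InPeriphery : ∀ {n} {G : Graph n} {c} → Deletion G c → Fin n → Set
InPeriphery Δ v = ¬ InCore Δ v

data WalkIn {n} (G : Graph n) (A : Fin n → Bool) : Fin n → Fin n → Set where
  here : ∀ {v} → A v ≡ true → WalkIn G A v v
  step : ∀ {u v w} → A u ≡ true → adj G u v ≡ true → WalkIn G A v w → WalkIn G A u w

IsPeripheryComponent : ∀ {n} {G : Graph n} {c} → Deletion G c → (Fin n → Bool) → Set
IsPeripheryComponent {n} {G} Δ A =
  (∃ λ (a : Fin n) → A a ≡ true) ×
  (∀ v → A v ≡ true → InPeriphery Δ v) ×
  (∀ u v → A u ≡ true → A v ≡ true → WalkIn G A u v) ×
  (∀ u v → A u ≡ true → InPeriphery Δ v → adj G u v ≡ true → A v ≡ true)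

-- A* = N(𝒞) ∩ A is empty: no vertex of A has a neighbour in the core
NoCloseVertices : ∀ {n} {G : Graph n} {c} → Deletion G c → (Fin n → Bool) → Set
NoCloseVertices {n} {G} Δ A =
  ∀ a w → A a ≡ true → adj G a w ≡ true → ¬ InCore Δ w

-- H (on Fin m) is the graph G − A, i.e. G[V ∖ A], presented via an
-- injective enumeration ι : Fin m → Fin n of V ∖ A that preserves adjacency.
record IsDeletionOf {n m : ℕ} (G : Graph n) (A : Fin n → Bool) (H : Graph m) : Set where
  field
    ι        : Fin m → Fin n
    ι-inj    : ∀ i j → ι i ≡ ι j → i ≡ j
    ι-out    : ∀ i → A (ι i) ≡ false
    ι-onto   : ∀ v → A v ≡ false → ∃ λ i → ι i ≡ v
    ι-adj    : ∀ i j → adj H i j ≡ adj G (ι i) (ι j)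

-- Forward: any STC-labeling of G restricts to G - A, and the restriction has
-- no more weak edges (restriction-yes; this holds for every vertex set A).
--
-- Backward: since A* = ∅ and A is a component of the periphery, every
-- neighbour of a vertex of A lies in A and no edge at A belongs to D, so
-- G[A] is a union of components of G with maximum degree ≤ c/2 + 1.  Such a
-- graph has a proper edge colouring with c colours (EdgeColouringTheorem,
-- proved by adding edges one at a time and repairing with Kempe chains,
-- using 2·(c/2) ≤ c and c/2 + 2 ≤ c).  Labeling the edges of G[A] strongly
-- by their colours and the rest as in G - A gives an STC-labeling of G with
-- the same weak edges (extension-yes).  Weak edges are compared through the
-- number of ordered weak pairs, which is twice the weak-edge count.

module Submission where

open import Data.Nat using (ℕ; zero; suc; _+_; _*_; _∸_; _≤_; _<_; _<ᵇ_; z≤n; s≤s)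
open import Data.Nat.Properties
open import Data.Nat.DivMod using (_%_; _/_; m≡m%n+[m/n]*n)
open import Data.Nat.ListAction using (sum)
open import Data.Nat.ListAction.Properties using (sum-++)
open import Algebra.Properties.Semiring.Sum +-*-semiring
  using (sum-cong-≗; ∑-distrib-+; ∑-comm; *-distribˡ-sum; sum-replicate-zero)
  renaming (sum to ∑)
open import Data.Bool using (Bool; true; false; _∧_; _∨_; not; if_then_else_)
open import Data.Bool.Properties using (T-≡; ∧-comm; ∨-comm; ∧-zeroʳ; ∧-identityʳ; ∨-zeroʳ; ∨-identityʳ; not-involutive)
open import Data.Fin using (Fin; zero; suc; toℕ; fromℕ<)
open import Data.Fin.Properties using (toℕ-injective) renaming (suc-injective to Fin-suc-injective)
open import Data.List using (List; map; concatMap; allFin; tabulate)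
open import Data.Maybe using (Maybe; just; nothing; _>>=_)
import Data.Maybe as Maybe
open import Data.Maybe.Properties using (just-injective)
open import Data.Product using (∃; _×_; _,_; proj₁; proj₂)
open import Data.Sum using (_⊎_; inj₁; inj₂)
open import Data.Empty using (⊥; ⊥-elim)
open import Function using (_∘_)
open import Function.Bundles using (_⇔_; mk⇔; Equivalence)
open import Relation.Binary using (tri<; tri≈; tri>)
open import Relation.Binary.PropositionalEquality
open import Relation.Nullary using (¬_)
open import Defs

t≢f : true ≢ false
t≢f ()

∧-true : ∀ {a b} → a ∧ b ≡ true → a ≡ true × b ≡ true
∧-true {true} {true} _ = refl , refl

∧-intro : ∀ {a b} → a ≡ true → b ≡ true → a ∧ b ≡ true
∧-intro refl refl = refl

∨-false : ∀ a {b} → a ∨ b ≡ false → a ≡ false × b ≡ false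
∨-false false e = refl , e

∨-inr : ∀ a {b} → b ≡ true → a ∨ b ≡ true
∨-inr a refl = ∨-zeroʳ a

∨-onlyˡ : ∀ {a} → a ∨ false ≡ true → a ≡ true
∨-onlyˡ {true} _ = refl

not-true : ∀ {a} → not a ≡ true → a ≡ false
not-true {false} _ = refl

not-false : ∀ {a} → not a ≡ false → a ≡ true
not-false {true} _ = refl

bool-cases : ∀ b → (b ≡ true) ⊎ (b ≡ false)
bool-cases true = inj₁ refl
bool-cases false = inj₂ refl

eqF : ∀ {n} → Fin n → Fin n → Bool
eqF zero zero = true
eqF zero (suc _) = false
eqF (suc _) zero = false
eqF (suc x) (suc y) = eqF x y

eqF-refl : ∀ {n} (x : Fin n) → eqF x x ≡ true
eqF-refl zero = refl
eqF-refl (suc x) = eqF-refl x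

eqF-sym : ∀ {n} (x y : Fin n) → eqF x y ≡ eqF y x
eqF-sym zero zero = refl
eqF-sym zero (suc y) = refl
eqF-sym (suc x) zero = refl
eqF-sym (suc x) (suc y) = eqF-sym x y

eqF-true : ∀ {n} {x y : Fin n} → eqF x y ≡ true → x ≡ y
eqF-true {x = zero} {zero} e = refl
eqF-true {x = suc x} {suc y} e = cong suc (eqF-true e)

eqF-false : ∀ {n} {x y : Fin n} → eqF x y ≡ false → x ≢ y
eqF-false {x = x} e refl = t≢f (trans (sym (eqF-refl x)) e)

eqF-≢ : ∀ {n} {x y : Fin n} → x ≢ y → eqF x y ≡ false
eqF-≢ {x = x} {y} x≢y with eqF x y in e
... | true = ⊥-elim (x≢y (eqF-true e))
... | false = refl

∑-mono : ∀ {n} {f g : Fin n → ℕ} → (∀ i → f i ≤ g i) → ∑ f ≤ ∑ g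
∑-mono {zero} _ = z≤n
∑-mono {suc n} f≤g = +-mono-≤ (f≤g zero) (∑-mono (f≤g ∘ suc))

∑-mono-< : ∀ {n} {f g : Fin n → ℕ} → (∀ i → f i ≤ g i) → (j : Fin n) → f j < g j → ∑ f < ∑ g
∑-mono-< f≤g zero fj<gj = +-mono-<-≤ fj<gj (∑-mono (f≤g ∘ suc))
∑-mono-< f≤g (suc j) fj<gj = +-mono-≤-< (f≤g zero) (∑-mono-< (f≤g ∘ suc) j fj<gj)

∑-indicator : ∀ {n} (a : Fin n) (h : Fin n → ℕ) → ∑ (λ x → boolℕ (eqF a x) * h x) ≡ h a
∑-indicator {suc n} zero h =
  trans (cong (h zero + 0 +_) (sum-replicate-zero n)) (trans (+-identityʳ _) (+-identityʳ _))
∑-indicator {suc n} (suc a) h = ∑-indicator a (h ∘ suc)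

cnt : ∀ {n} → (Fin n → Bool) → ℕ
cnt P = ∑ (boolℕ ∘ P)

boolℕ-mono : ∀ {a b} → (a ≡ true → b ≡ true) → boolℕ a ≤ boolℕ b
boolℕ-mono {false} _ = z≤n
boolℕ-mono {true} a⇒b rewrite a⇒b refl = ≤-refl

cnt-cong : ∀ {n} {P Q : Fin n → Bool} → (∀ i → P i ≡ Q i) → cnt P ≡ cnt Q
cnt-cong P≗Q = sum-cong-≗ (cong boolℕ ∘ P≗Q)

cnt-mono : ∀ {n} {P Q : Fin n → Bool} → (∀ i → P i ≡ true → Q i ≡ true) → cnt P ≤ cnt Q
cnt-mono P⊆Q = ∑-mono (boolℕ-mono ∘ P⊆Q)

cnt-mono-< : ∀ {n} {P Q : Fin n → Bool} → (∀ i → P i ≡ true → Q i ≡ true) →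
  (j : Fin n) → P j ≡ false → Q j ≡ true → cnt P < cnt Q
cnt-mono-< P⊆Q j Pj Qj = ∑-mono-< (boolℕ-mono ∘ P⊆Q) j (lt Pj Qj)
  where lt : ∀ {a b} → a ≡ false → b ≡ true → boolℕ a < boolℕ b
        lt refl refl = s≤s z≤n

cnt-none : ∀ {n} (P : Fin n → Bool) → (∀ i → P i ≡ false) → cnt P ≡ 0
cnt-none {zero} P _ = refl
cnt-none {suc n} P none rewrite none zero = cnt-none (P ∘ suc) (none ∘ suc)

cnt-all : ∀ {n} (P : Fin n → Bool) → (∀ i → P i ≡ true) → cnt P ≡ n
cnt-all {zero} P _ = refl
cnt-all {suc n} P all rewrite all zero = cong suc (cnt-all (P ∘ suc) (all ∘ suc))

cnt-≤-size : ∀ {n} (P : Fin n → Bool) → cnt P ≤ n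
cnt-≤-size {n} P = ≤-trans (cnt-mono {n} {Q = λ _ → true} (λ _ _ → refl)) (≤-reflexive (cnt-all {n} _ λ _ → refl))

cnt-point : ∀ {n} (a : Fin n) → cnt (eqF a) ≡ 1
cnt-point {n} a = trans (sum-cong-≗ {n} (λ x → sym (*-identityʳ _))) (∑-indicator a (λ _ → 1))

cnt-pos : ∀ {n} {P : Fin n → Bool} (a : Fin n) → P a ≡ true → 1 ≤ cnt P
cnt-pos {n} {P = P} a Pa =
  ≤-trans (≤-reflexive (sym (cnt-point a))) (cnt-mono {n} (λ i e → subst (λ z → P z ≡ true) (eqF-true e) Pa))

cnt-∨ : ∀ {n} (P Q : Fin n → Bool) → cnt (λ i → P i ∨ Q i) ≤ cnt P + cnt Q
cnt-∨ {n} P Q = ≤-trans (∑-mono {n} (λ i → boolℕ-∨ (P i) (Q i))) (≤-reflexive (∑-distrib-+ (boolℕ ∘ P) (boolℕ ∘ Q)))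
  where boolℕ-∨ : ∀ a b → boolℕ (a ∨ b) ≤ boolℕ a + boolℕ b
        boolℕ-∨ true b = s≤s z≤n
        boolℕ-∨ false b = ≤-refl

cnt-unique : ∀ {n} (P : Fin n → Bool) → (∀ i j → P i ≡ true → P j ≡ true → i ≡ j) → cnt P ≤ 1
cnt-unique {zero} P _ = z≤n
cnt-unique {suc n} P unique with P zero in P0
... | true = ≤-reflexive (cong suc (cnt-none (P ∘ suc) others))
  where others : ∀ i → P (suc i) ≡ false
        others i with P (suc i) in Pi
        ... | false = refl
        ... | true with unique zero (suc i) P0 Pi
        ...   | ()
... | false = cnt-unique (P ∘ suc) (λ i j Pi Pj → Fin-suc-injective (unique (suc i) (suc j) Pi Pj))

covering-disjoint : ∀ {k} (p q : Fin k → Bool) → cnt p + cnt q ≤ k →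
  (∀ γ → p γ ≡ false → q γ ≡ true) → ∀ γ → p γ ≡ true → q γ ≡ true → ⊥
covering-disjoint {k} p q small covers γ pγ qγ = <-irrefl refl (<-≤-trans more small)
  where
  atLeastOne : ∀ δ → 1 ≤ boolℕ (p δ) + boolℕ (q δ)
  atLeastOne δ with p δ in pδ
  ... | true = s≤s z≤n
  ... | false rewrite covers δ pδ = s≤s z≤n
  more : k < cnt p + cnt q
  more = begin-strict
      k
    ≡⟨ sym (cnt-all {k} (λ _ → true) (λ _ → refl)) ⟩
      ∑ {k} (λ _ → 1)
    <⟨ ∑-mono-< {k} atLeastOne γ (subst (λ z → 1 < z) (sym (cong₂ (λ a b → boolℕ a + boolℕ b) pγ qγ)) (s≤s (s≤s z≤n))) ⟩
      ∑ (λ δ → boolℕ (p δ) + boolℕ (q δ))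
    ≡⟨ ∑-distrib-+ (boolℕ ∘ p) (boolℕ ∘ q) ⟩
      cnt p + cnt q
    ∎
    where open ≤-Reasoning

anyF : ∀ {n} → (Fin n → Bool) → Bool
anyF {zero} P = false
anyF {suc n} P = P zero ∨ anyF (P ∘ suc)

anyF-true : ∀ {n} (P : Fin n → Bool) → anyF P ≡ true → ∃ λ i → P i ≡ true
anyF-true {suc n} P e with P zero in P0
... | true = zero , P0
... | false = let (i , Pi) = anyF-true (P ∘ suc) e in suc i , Pi

anyF-false : ∀ {n} (P : Fin n → Bool) → anyF P ≡ false → ∀ i → P i ≡ false
anyF-false {suc n} P e i with P zero in P0
anyF-false {suc n} P e zero | false = P0
anyF-false {suc n} P e (suc i) | false = anyF-false (P ∘ suc) e i

anyF-intro : ∀ {n} (P : Fin n → Bool) (i : Fin n) → P i ≡ true → anyF P ≡ true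
anyF-intro P zero Pi rewrite Pi = refl
anyF-intro P (suc i) Pi = ∨-inr (P zero) (anyF-intro (P ∘ suc) i Pi)

search : ∀ {n} (P : Fin n → Bool) → (∃ λ i → P i ≡ true) ⊎ (∀ i → P i ≡ false)
search P with anyF P in e
... | true = inj₁ (anyF-true P e)
... | false = inj₂ (anyF-false P e)

anyF≤cnt : ∀ {n} (P : Fin n → Bool) → boolℕ (anyF P) ≤ cnt P
anyF≤cnt P with anyF P in e
... | false = z≤n
... | true = let (i , Pi) = anyF-true P e in cnt-pos i Pi

cnt<⇒false : ∀ {n} (P : Fin n → Bool) → cnt P < n → ∃ λ i → P i ≡ false
cnt<⇒false P lt with search (not ∘ P)
... | inj₁ (i , e) = i , not-true e
... | inj₂ h = ⊥-elim (<-irrefl (cnt-all P (not-false ∘ h)) lt)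

findF : ∀ {n} → (Fin n → Bool) → Maybe (Fin n)
findF {zero} P = nothing
findF {suc n} P with P zero
... | true = just zero
... | false = Maybe.map suc (findF (P ∘ suc))

findF-just : ∀ {n} (P : Fin n → Bool) {y} → findF P ≡ just y → P y ≡ true
findF-just {suc n} P e with P zero in P0
findF-just {suc n} P refl | true = P0
... | false with findF (P ∘ suc) in f
findF-just {suc n} P refl | false | just i = findF-just (P ∘ suc) f

findF-nothing : ∀ {n} (P : Fin n → Bool) → findF P ≡ nothing → ∀ y → P y ≡ false
findF-nothing {suc n} P e y with P zero in P0
findF-nothing {suc n} P () y | true
... | false with findF (P ∘ suc) in f
findF-nothing {suc n} P e zero | false | nothing = P0
findF-nothing {suc n} P e (suc y) | false | nothing = findF-nothing (P ∘ suc) f y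

-- Proper partial edge colourings

module EdgeColouring {n k : ℕ} where

  EdgeRel : Set
  EdgeRel = Fin n → Fin n → Bool

  Colouring : Set
  Colouring = Fin n → Fin n → Fin k

  record Proper (E : EdgeRel) (col : Colouring) : Set where
    field
      col-sym : ∀ x y → E x y ≡ true → col x y ≡ col y x
      col-inj : ∀ x y z → E x y ≡ true → E x z ≡ true → col x y ≡ col x z → y ≡ z
  open Proper public

  Misses : EdgeRel → Colouring → Fin n → Fin k → Set
  Misses E col x γ = ∀ y → E x y ≡ true → col x y ≢ γ

  present : EdgeRel → Colouring → Fin n → Fin k → Bool
  present E col x γ = anyF (λ y → E x y ∧ eqF (col x y) γ)

  present-false : ∀ E col x γ → present E col x γ ≡ false → Misses E col x γ
  present-false E col x γ e y Exy refl =
    t≢f (trans (sym (∧-intro Exy (eqF-refl (col x y)))) (anyF-false _ e y))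

  present-true : ∀ E col x γ → present E col x γ ≡ true → ∃ λ y → E x y ≡ true × col x y ≡ γ
  present-true E col x γ e =
    let (y , q) = anyF-true _ e ; (Exy , c) = ∧-true q in y , Exy , eqF-true c

  misses⇒absent : ∀ E col x γ → Misses E col x γ → present E col x γ ≡ false
  misses⇒absent E col x γ miss with present E col x γ in e
  ... | false = refl
  ... | true = let (y , Exy , c) = present-true E col x γ e in ⊥-elim (miss y Exy c)

  -- each edge at x contributes at most one present colour
  #present≤deg : ∀ E col x → cnt (present E col x) ≤ cnt (E x)
  #present≤deg E col x = begin
      cnt (present E col x)
    ≤⟨ ∑-mono {k} (λ γ → anyF≤cnt (λ y → E x y ∧ eqF (col x y) γ)) ⟩
      ∑ (λ γ → ∑ (λ y → boolℕ (E x y ∧ eqF (col x y) γ)))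
    ≡⟨ ∑-comm {k} {n} (λ γ y → boolℕ (E x y ∧ eqF (col x y) γ)) ⟩
      ∑ (λ y → ∑ (λ γ → boolℕ (E x y ∧ eqF (col x y) γ)))
    ≡⟨ sum-cong-≗ {n} edgeTerm ⟩
      cnt (E x)
    ∎
    where
    open ≤-Reasoning
    edgeTerm : ∀ y → ∑ (λ γ → boolℕ (E x y ∧ eqF (col x y) γ)) ≡ boolℕ (E x y)
    edgeTerm y with E x y
    ... | true = cnt-point (col x y)
    ... | false = sum-replicate-zero k

  missing : ∀ E col x → cnt (E x) < k → ∃ λ γ → Misses E col x γ
  missing E col x deg<k =
    let (γ , e) = cnt<⇒false (present E col x) (≤-<-trans (#present≤deg E col x) deg<k)
    in γ , present-false E col x γ e

  missing-≢ : ∀ E col x (α : Fin k) → suc (cnt (E x)) < k → ∃ λ γ → γ ≢ α × Misses E col x γ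
  missing-≢ E col x α deg<k-1 =
    let (γ , e) = cnt<⇒false (λ γ → present E col x γ ∨ eqF γ α) bound
        (absent , γ≢α) = ∨-false (present E col x γ) e
    in γ , eqF-false γ≢α , present-false E col x γ absent
    where
    bound : cnt (λ γ → present E col x γ ∨ eqF γ α) < k
    bound = begin-strict
        cnt (λ γ → present E col x γ ∨ eqF γ α)
      ≤⟨ cnt-∨ (present E col x) (λ γ → eqF γ α) ⟩
        cnt (present E col x) + cnt (λ γ → eqF γ α)
      ≡⟨ cong (cnt (present E col x) +_) (trans (cnt-cong {k} (λ γ → eqF-sym γ α)) (cnt-point α)) ⟩
        cnt (present E col x) + 1
      ≡⟨ +-comm _ 1 ⟩
        suc (cnt (present E col x))
      <⟨ ≤-<-trans (s≤s (#present≤deg E col x)) deg<k-1 ⟩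
        k
      ∎
      where open ≤-Reasoning

  isPair : Fin n → Fin n → Fin n → Fin n → Bool
  isPair u v x y = (eqF x u ∧ eqF y v) ∨ (eqF x v ∧ eqF y u)

  addEdge : EdgeRel → Fin n → Fin n → EdgeRel
  addEdge E u v x y = E x y ∨ isPair u v x y

  delEdge : EdgeRel → Fin n → Fin n → EdgeRel
  delEdge E u v x y = E x y ∧ not (isPair u v x y)

  recolour : Colouring → Fin n → Fin n → Fin k → Colouring
  recolour col u v γ x y = if isPair u v x y then γ else col x y

  isPair-sym : ∀ u v x y → isPair u v x y ≡ isPair u v y x
  isPair-sym u v x y =
    trans (∨-comm (eqF x u ∧ eqF y v) _) (cong₂ _∨_ (∧-comm (eqF x v) _) (∧-comm (eqF x u) _))

  isPair-view : ∀ u v x y → isPair u v x y ≡ true → (x ≡ u × y ≡ v) ⊎ (x ≡ v × y ≡ u)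
  isPair-view u v x y e with eqF x u in e1 | eqF y v in e2
  ... | true | true = inj₁ (eqF-true e1 , eqF-true e2)
  ... | true | false = inj₂ (let (a , b) = ∧-true e in eqF-true a , eqF-true b)
  ... | false | _ = inj₂ (let (a , b) = ∧-true e in eqF-true a , eqF-true b)

  isPair-uv : ∀ u v → isPair u v u v ≡ true
  isPair-uv u v rewrite eqF-refl u | eqF-refl v = refl

  isPair-vu : ∀ u v → isPair u v v u ≡ true
  isPair-vu u v = trans (isPair-sym u v v u) (isPair-uv u v)

  isPair-outside : ∀ u v x y → x ≢ u → x ≢ v → isPair u v x y ≡ false
  isPair-outside u v x y x≢u x≢v rewrite eqF-≢ x≢u | eqF-≢ x≢v = refl

  isPair-endpoint : ∀ u v x y → isPair u v x y ≡ true → (x ≡ u) ⊎ (x ≡ v)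
  isPair-endpoint u v x y p with isPair-view u v x y p
  ... | inj₁ (x≡u , _) = inj₁ x≡u
  ... | inj₂ (x≡v , _) = inj₂ x≡v

  isPair-functional : ∀ u v x y z → u ≢ v → isPair u v x y ≡ true → isPair u v x z ≡ true → y ≡ z
  isPair-functional u v x y z u≢v p q with isPair-view u v x y p | isPair-view u v x z q
  ... | inj₁ (_ , y≡v) | inj₁ (_ , z≡v) = trans y≡v (sym z≡v)
  ... | inj₁ (x≡u , _) | inj₂ (x≡v , _) = ⊥-elim (u≢v (trans (sym x≡u) x≡v))
  ... | inj₂ (x≡v , _) | inj₁ (x≡u , _) = ⊥-elim (u≢v (trans (sym x≡u) x≡v))
  ... | inj₂ (_ , y≡u) | inj₂ (_ , z≡u) = trans y≡u (sym z≡u)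

  delEdge-⊆ : ∀ E u v x y → delEdge E u v x y ≡ true → E x y ≡ true
  delEdge-⊆ E u v x y = proj₁ ∘ ∧-true

  proper-⊆ : ∀ {E E' col} → (∀ x y → E' x y ≡ true → E x y ≡ true) → Proper E col → Proper E' col
  proper-⊆ E'⊆E P = record
    { col-sym = λ x y e → col-sym P x y (E'⊆E x y e)
    ; col-inj = λ x y z e₁ e₂ → col-inj P x y z (E'⊆E x y e₁) (E'⊆E x z e₂) }

  proper-addEdge : ∀ {E col} u v γ → u ≢ v → Proper E col →
    Misses E col u γ → Misses E col v γ → Proper (addEdge E u v) (recolour col u v γ)
  proper-addEdge {E} {col} u v γ u≢v P mu mv = record { col-sym = sym' ; col-inj = inj' }
    where
    missAtEnd : ∀ x → (x ≡ u) ⊎ (x ≡ v) → Misses E col x γ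
    missAtEnd x (inj₁ refl) = mu
    missAtEnd x (inj₂ refl) = mv
    sym' : ∀ x y → addEdge E u v x y ≡ true → recolour col u v γ x y ≡ recolour col u v γ y x
    sym' x y e with isPair u v x y in p | isPair u v y x in q
    ... | true | true = refl
    ... | false | false = col-sym P x y (∨-onlyˡ e)
    ... | true | false = ⊥-elim (t≢f (trans (sym p) (trans (isPair-sym u v x y) q)))
    ... | false | true = ⊥-elim (t≢f (trans (sym q) (trans (sym (isPair-sym u v x y)) p)))
    inj' : ∀ x y z → addEdge E u v x y ≡ true → addEdge E u v x z ≡ true →
      recolour col u v γ x y ≡ recolour col u v γ x z → y ≡ z
    inj' x y z e₁ e₂ c with isPair u v x y in p₁ | isPair u v x z in p₂
    ... | true | true = isPair-functional u v x y z u≢v p₁ p₂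
    ... | true | false = ⊥-elim (missAtEnd x (isPair-endpoint u v x y p₁) z (∨-onlyˡ e₂) (sym c))
    ... | false | true = ⊥-elim (missAtEnd x (isPair-endpoint u v x z p₂) y (∨-onlyˡ e₁) c)
    ... | false | false = col-inj P x y z (∨-onlyˡ e₁) (∨-onlyˡ e₂) c

-- Kempe chains
--
-- For colours a ≠ b, exchanging a and b on all edges leaving a set K of
-- vertices that is closed under (a,b)-coloured edges keeps a colouring
-- proper.  The (a,b)-component of a vertex v missing b is such a set, and
-- it is a path starting at v: apart from v it contains at most one vertex
-- missing a.

module Kempe {n k : ℕ} (E : EdgeColouring.EdgeRel {n} {k}) (col : EdgeColouring.Colouring {n} {k})
  (P : EdgeColouring.Proper E col) (E-sym : ∀ x y → E x y ≡ E y x)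
  (a b : Fin k) (a≢b : a ≢ b) where

  open EdgeColouring {n} {k}

  inAB : Fin k → Bool
  inAB γ = eqF γ a ∨ eqF γ b

  σ : Fin k → Fin k
  σ γ = if eqF γ a then b else (if eqF γ b then a else γ)

  σ-a : σ a ≡ b
  σ-a rewrite eqF-refl a = refl

  σ-b : σ b ≡ a
  σ-b rewrite eqF-≢ (a≢b ∘ sym) | eqF-refl b = refl

  σ-fix : ∀ γ → inAB γ ≡ false → σ γ ≡ γ
  σ-fix γ e with eqF γ a | eqF γ b
  σ-fix γ () | true | _
  σ-fix γ () | false | true
  ... | false | false = refl

  σ-involutive : ∀ γ → σ (σ γ) ≡ γ
  σ-involutive γ with eqF γ a in e₁
  ... | true = trans σ-b (sym (eqF-true e₁))
  ... | false with eqF γ b in e₂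
  ...   | true = trans σ-a (sym (eqF-true e₂))
  ...   | false rewrite e₁ | e₂ = refl

  σ-inj : ∀ {x y} → σ x ≡ σ y → x ≡ y
  σ-inj {x} {y} e = trans (sym (σ-involutive x)) (trans (cong σ e) (σ-involutive y))

  σ-unapply : ∀ {γ δ} → σ γ ≡ δ → γ ≡ σ δ
  σ-unapply {γ} e = trans (sym (σ-involutive γ)) (cong σ e)

  switch : (Fin n → Bool) → Colouring
  switch K x y = if K x then σ (col x y) else col x y

  Closed : (Fin n → Bool) → Set
  Closed K = ∀ x y → K x ≡ true → E x y ≡ true → inAB (col x y) ≡ true → K y ≡ true

  leaving-notAB : ∀ {K} → Closed K → ∀ x y → K x ≡ true → K y ≡ false → E x y ≡ true → inAB (col x y) ≡ false
  leaving-notAB closed x y Kx Ky Exy with inAB (col x y) in e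
  ... | false = refl
  ... | true = ⊥-elim (t≢f (trans (sym (closed x y Kx Exy e)) Ky))

  proper-switch : ∀ K → Closed K → Proper E (switch K)
  proper-switch K closed = record { col-sym = sym' ; col-inj = inj' }
    where
    sym' : ∀ x y → E x y ≡ true → switch K x y ≡ switch K y x
    sym' x y Exy with K x in Kx | K y in Ky
    ... | true | true = cong σ (col-sym P x y Exy)
    ... | false | false = col-sym P x y Exy
    ... | true | false = trans (σ-fix _ (leaving-notAB closed x y Kx Ky Exy)) (col-sym P x y Exy)
    ... | false | true =
      trans (col-sym P x y Exy) (sym (σ-fix _ (leaving-notAB closed y x Ky Kx (trans (E-sym y x) Exy))))
    inj' : ∀ x y z → E x y ≡ true → E x z ≡ true → switch K x y ≡ switch K x z → y ≡ z
    inj' x y z Exy Exz c with K x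
    ... | true = col-inj P x y z Exy Exz (σ-inj c)
    ... | false = col-inj P x y z Exy Exz c

  switch-outside : ∀ K x y → K x ≡ false → switch K x y ≡ col x y
  switch-outside K x y Kx rewrite Kx = refl

  switch-misses-outside : ∀ K x γ → K x ≡ false → Misses E col x γ → Misses E (switch K) x γ
  switch-misses-outside K x γ Kx miss y Exy rewrite Kx = miss y Exy

  switch-misses-a : ∀ K x → K x ≡ true → Misses E col x b → Misses E (switch K) x a
  switch-misses-a K x Kx miss y Exy rewrite Kx = λ e → miss y Exy (trans (σ-unapply e) σ-a)

  switch-other : ∀ K x y γ → γ ≢ a → γ ≢ b → switch K x y ≡ γ → col x y ≡ γ
  switch-other K x y γ γ≢a γ≢b e with K x
  ... | false = e
  ... | true = trans (σ-unapply e) (σ-fix γ notAB)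
    where notAB : inAB γ ≡ false
          notAB rewrite eqF-≢ γ≢a | eqF-≢ γ≢b = refl

  switch-a : ∀ K x y → K x ≡ true → switch K x y ≡ a → col x y ≡ b
  switch-a K x y Kx e rewrite Kx = trans (σ-unapply e) σ-a

  module Component (v : Fin n) (v-misses-b : Misses E col v b) where

    abEdge : Fin n → Fin n → Bool
    abEdge x y = E x y ∧ inAB (col x y)

    reach : ℕ → Fin n → Bool
    reach zero x = eqF x v
    reach (suc t) x = reach t x ∨ anyF (λ y → reach t y ∧ abEdge y x)

    reach-suc : ∀ t x → reach t x ≡ true → reach (suc t) x ≡ true
    reach-suc t x e rewrite e = refl

    Stable : ℕ → Set
    Stable t = ∀ x → reach (suc t) x ≡ true → reach t x ≡ true

    stable-suc : ∀ t → Stable t → Stable (suc t)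
    stable-suc t st x e with reach (suc t) x in e₁
    ... | true = refl
    ... | false =
      let (y , q) = anyF-true _ e ; (ry , ey) = ∧-true q
      in ⊥-elim (t≢f (trans (sym (∨-inr (reach t x) (anyF-intro (λ y → reach t y ∧ abEdge y x) y (∧-intro (st y ry) ey)))) e₁))

    grows : ∀ t → Stable t ⊎ (t < cnt (reach t))
    grows zero = inj₂ (cnt-pos v (eqF-refl v))
    grows (suc t) with grows t
    ... | inj₁ st = inj₁ (stable-suc t st)
    ... | inj₂ t<#r with search (λ x → reach (suc t) x ∧ not (reach t x))
    ...   | inj₁ (x , e) = let (new , old) = ∧-true e in
            inj₂ (<-≤-trans (s≤s t<#r) (cnt-mono-< (reach-suc t) x (not-true old) new))
    ...   | inj₂ none = inj₁ (stable-suc t (λ x e → no-new (reach t x) e (none x)))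
      where no-new : ∀ c {d} → d ≡ true → d ∧ not c ≡ false → c ≡ true
            no-new true _ _ = refl
            no-new false refl ()

    -- reach cannot grow for n steps, as it has at most n elements
    stable-n : Stable n
    stable-n with grows n
    ... | inj₁ st = st
    ... | inj₂ n<#r = ⊥-elim (<-irrefl refl (<-≤-trans n<#r (cnt-≤-size (reach n))))

    K : Fin n → Bool
    K = reach n

    K-closed : Closed K
    K-closed x y Kx Exy ab =
      stable-n y (∨-inr (reach n y) (anyF-intro (λ z → reach n z ∧ abEdge z y) x (∧-intro Kx (∧-intro Exy ab))))

    reach-v : ∀ t → reach t v ≡ true
    reach-v zero = eqF-refl v
    reach-v (suc t) = reach-suc t v (reach-v t)

    K-v : K v ≡ true
    K-v = reach-v n

    partner : Fin k → Fin n → Maybe (Fin n)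
    partner γ x = findF (λ y → E x y ∧ eqF (col x y) γ)

    partner-just : ∀ γ x y → partner γ x ≡ just y → E x y ≡ true × col x y ≡ γ
    partner-just γ x y e = let (Exy , c) = ∧-true (findF-just _ e) in Exy , eqF-true c

    partner-of : ∀ γ x y → E x y ≡ true → col x y ≡ γ → partner γ x ≡ just y
    partner-of γ x y Exy c with partner γ x in e
    ... | just y' = let (Exy' , c') = partner-just γ x y' e in cong just (col-inj P x y' y Exy' Exy (trans c' (sym c)))
    ... | nothing = ⊥-elim (t≢f (trans (sym (∧-intro Exy (subst (λ z → eqF z γ ≡ true) (sym c) (eqF-refl γ)))) (findF-nothing _ e y)))

    partner-missing : ∀ γ x → Misses E col x γ → partner γ x ≡ nothing
    partner-missing γ x miss with partner γ x in e
    ... | nothing = refl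
    ... | just y = let (Exy , c) = partner-just γ x y e in ⊥-elim (miss y Exy c)

    -- the alternating walk from v, first along a; the flag says whether the
    -- next edge to take has colour a (true) or b (false)
    colourOf : Bool → Fin k
    colourOf true = a
    colourOf false = b

    walkStep : Fin n × Bool → Maybe (Fin n × Bool)
    walkStep (x , t) = Maybe.map (λ y → (y , not t)) (partner (colourOf t) x)

    walk : ℕ → Maybe (Fin n × Bool)
    walk zero = just (v , true)
    walk (suc i) = walk i >>= walkStep

    walk-step : ∀ i x t y → walk i ≡ just (x , t) → partner (colourOf t) x ≡ just y → walk (suc i) ≡ just (y , not t)
    walk-step i x t y e p rewrite e | p = refl

    walk-stop : ∀ i x t → walk i ≡ just (x , t) → partner (colourOf t) x ≡ nothing → walk (suc i) ≡ nothing
    walk-stop i x t e p rewrite e | p = refl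

    walk-ended : ∀ i j → walk i ≡ nothing → walk (j + i) ≡ nothing
    walk-ended i zero e = e
    walk-ended i (suc j) e rewrite walk-ended i j e = refl

    walk-back : ∀ i y t → walk (suc i) ≡ just (y , t) →
      ∃ λ x → walk i ≡ just (x , not t) × partner (colourOf (not t)) x ≡ just y
    walk-back i y t e with walk i in e₁
    ... | just (x , s) with partner (colourOf s) x in e₂
    walk-back i y t refl | just (x , s) | just y' =
      x , cong (λ z → just (x , z)) (sym (not-involutive s)) ,
      subst (λ z → partner (colourOf z) x ≡ just y') (sym (not-involutive s)) e₂

    colourOf-cases : ∀ t γ → inAB γ ≡ true → (γ ≡ colourOf t) ⊎ (γ ≡ colourOf (not t))
    colourOf-cases t γ e with eqF γ a in e₁
    colourOf-cases true γ e | true = inj₁ (eqF-true e₁)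
    colourOf-cases false γ e | true = inj₂ (eqF-true e₁)
    colourOf-cases true γ e | false = inj₂ (eqF-true e)
    colourOf-cases false γ e | false = inj₁ (eqF-true e)

    OnWalk : Fin n → Set
    OnWalk x = ∃ λ j → ∃ λ s → walk j ≡ just (x , s)

    -- an (a,b)-neighbour of a walk vertex is on the walk: either the next
    -- or the previous vertex (at v, the previous edge would have colour b)
    onWalk-neighbour : ∀ i y t x → walk i ≡ just (y , t) → E y x ≡ true → inAB (col y x) ≡ true → OnWalk x
    onWalk-neighbour i y t x e Eyx ab with colourOf-cases t (col y x) ab
    ... | inj₁ c = suc i , not t , walk-step i y t x e (partner-of (colourOf t) y x Eyx c)
    onWalk-neighbour zero y t x refl Eyx ab | inj₂ c = ⊥-elim (v-misses-b x Eyx c)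
    onWalk-neighbour (suc i) y t x e Eyx ab | inj₂ c =
      let (z , e' , p) = walk-back i y t e
          (Ezy , czy) = partner-just (colourOf (not t)) z y p
          cyz = trans (sym (col-sym P z y Ezy)) czy
          z≡x = col-inj P y z x (trans (E-sym y z) Ezy) Eyx (trans cyz (sym c))
      in i , not t , subst (λ w → walk i ≡ just (w , not t)) z≡x e'

    onWalk-reach : ∀ t x → reach t x ≡ true → OnWalk x
    onWalk-reach zero x e = zero , true , cong (λ w → just (w , true)) (sym (eqF-true e))
    onWalk-reach (suc t) x e with reach t x in e₁
    ... | true = onWalk-reach t x e₁
    ... | false =
      let (y , r) = anyF-true _ e ; (ry , ey) = ∧-true r ; (Eyx , ab) = ∧-true ey
          (j , s , wj) = onWalk-reach t y ry
      in onWalk-neighbour j y s x wj Eyx ab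

    walk-stops : ∀ i x t → x ≢ v → Misses E col x a → walk i ≡ just (x , t) → walk (suc i) ≡ nothing
    walk-stops zero x t x≢v _ refl = ⊥-elim (x≢v refl)
    walk-stops (suc i) x t x≢v miss e with walk-back i x t e
    ... | (z , _ , p) with t
    ...   | true = walk-stop (suc i) x true e (partner-missing a x miss)
    ...   | false = let (Ezx , czx) = partner-just a z x p in
                    ⊥-elim (miss z (trans (E-sym x z) Ezx) (trans (sym (col-sym P z x Ezx)) czx))

    walk-last : ∀ i x t j y s → x ≢ v → Misses E col x a → walk i ≡ just (x , t) → i < j → walk j ≡ just (y , s) → ⊥
    walk-last i x t j y s x≢v miss wi i<j wj =
      just≢nothing (trans (sym wj) (trans (cong walk (sym (m∸n+n≡m i<j))) (walk-ended (suc i) (j ∸ suc i) (walk-stops i x t x≢v miss wi))))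
      where just≢nothing : ∀ {A : Set} {z : A} → just z ≢ nothing
            just≢nothing ()

    one-end : ∀ u w → u ≢ w → u ≢ v → w ≢ v → Misses E col u a → Misses E col w a → K u ≡ true → K w ≡ true → ⊥
    one-end u w u≢w u≢v w≢v mu mw Ku Kw with onWalk-reach n u Ku | onWalk-reach n w Kw
    ... | (i , s , wi) | (j , s' , wj) with <-cmp i j
    ...   | tri< i<j _ _ = walk-last i u s j w s' u≢v mu wi i<j wj
    ...   | tri> _ _ j<i = walk-last j w s' i u s w≢v mw wj j<i wi
    ...   | tri≈ _ refl _ = u≢w (cong proj₁ (just-injective (trans (sym wi) wj)))

-- Adding one edge to a properly coloured graph
--
-- If u and v miss a common colour, use it for uv.
-- Otherwise every colour is present at exactly one of u, v (counting, as
-- 2d ≤ k).  Take α missing at u and the edge vw of colour α; give uv the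
-- colour α and recolour vw by a colour α' ≠ α missing at w in E - vw
-- (it exists as d + 2 ≤ k).  If α' is present at v, it is missing at u, and
-- an (α',β)-Kempe chain from v, with β missing at v, frees α' at v.

module OneEdgeExtension {n k d : ℕ} (2d≤k : d + d ≤ k) (d+2≤k : suc (suc d) ≤ k) where

  open EdgeColouring {n} {k}

  Extensible : EdgeRel → Fin n → Fin n → Set
  Extensible E u v = ∃ λ col → Proper (addEdge E u v) col

  d<k : d < k
  d<k = ≤-trans (n≤1+n (suc d)) d+2≤k

  misses-addEdge-outside : ∀ E col u v α x γ → x ≢ u → x ≢ v →
    Misses E col x γ → Misses (addEdge E u v) (recolour col u v α) x γ
  misses-addEdge-outside E col u v α x γ x≢u x≢v miss y e rewrite isPair-outside u v x y x≢u x≢v = miss y (∨-onlyˡ e)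

  misses-addEdge-end : ∀ E col u v α x γ → γ ≢ α →
    Misses E col x γ → Misses (addEdge E u v) (recolour col u v α) x γ
  misses-addEdge-end E col u v α x γ γ≢α miss y e with isPair u v x y
  ... | true = γ≢α ∘ sym
  ... | false = miss y (∨-onlyˡ e)

  readd-⊇ : ∀ E u v w x y → addEdge E u v x y ≡ true → addEdge (addEdge (delEdge E v w) u v) v w x y ≡ true
  readd-⊇ E u v w x y e with isPair v w x y
  ... | true = ∨-zeroʳ _
  ... | false with E x y
  ...   | true = refl
  ...   | false = trans (∨-identityʳ (isPair u v x y)) e

  module NoCommonMissing (E : EdgeRel) (col : Colouring) (P : Proper E col) (E-sym : ∀ x y → E x y ≡ E y x)
    (u v : Fin n) (u≢v : u ≢ v) (deg-u : cnt (E u) ≤ d) (deg-v : cnt (E v) ≤ d)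
    (covers : ∀ γ → present E col u γ ≡ false → present E col v γ ≡ true)
    (α : Fin k) (u-misses-α : Misses E col u α) (w : Fin n) (Evw : E v w ≡ true) (cvw : col v w ≡ α)
    (w≢u : w ≢ u) (w≢v : w ≢ v)
    (α' : Fin k) (α'≢α : α' ≢ α) (w-misses-α'₁ : Misses (delEdge E v w) col w α') where

    E₁ : EdgeRel
    E₁ = delEdge E v w
    E₁⊆E : ∀ x y → E₁ x y ≡ true → E x y ≡ true
    E₁⊆E = delEdge-⊆ E v w

    misses₁ : ∀ x γ → Misses E col x γ → Misses E₁ col x γ
    misses₁ x γ miss y e = miss y (E₁⊆E x y e)

    not-present-at-both : ∀ γ → present E col u γ ≡ true → present E col v γ ≡ true → ⊥
    not-present-at-both = covering-disjoint (present E col u) (present E col v)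
      (≤-trans (+-mono-≤ (≤-trans (#present≤deg E col u) deg-u) (≤-trans (#present≤deg E col v) deg-v)) 2d≤k) covers

    v-misses-α₁ : Misses E₁ col v α
    v-misses-α₁ y e c = t≢f (trans (sym e) (trans (cong (E₁ v) y≡w) vw-deleted))
      where
      y≡w : y ≡ w
      y≡w = col-inj P v y w (E₁⊆E v y e) Evw (trans c (sym cvw))
      vw-deleted : E₁ v w ≡ false
      vw-deleted rewrite isPair-uv v w = ∧-zeroʳ (E v w)

    -- the only edge at w deleted, wv, has colour α ≠ α'
    w-misses-α' : Misses E col w α'
    w-misses-α' y Ewy c with eqF y v in y≟v
    ... | true = α'≢α (trans (sym c) (subst (λ z → col w z ≡ α) (sym (eqF-true y≟v)) (trans (sym (col-sym P v w Evw)) cvw)))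
    ... | false = w-misses-α'₁ y E₁wy c
      where E₁wy : E₁ w y ≡ true
            E₁wy rewrite eqF-≢ w≢v | eqF-refl w | y≟v | Ewy = refl

    E₂ : EdgeRel
    E₂ = addEdge E₁ u v

    readd-vw : ∀ {col₂} → Proper E₂ col₂ → ∀ γ → Misses E₂ col₂ v γ → Misses E₂ col₂ w γ → Extensible E u v
    readd-vw {col₂} P₂ γ mv mw =
      recolour col₂ v w γ , proper-⊆ (readd-⊇ E u v w) (proper-addEdge v w γ (w≢v ∘ sym) P₂ mv mw)

    α'-free-at-v : Misses E col v α' → Extensible E u v
    α'-free-at-v v-misses-α' = readd-vw
      (proper-addEdge u v α u≢v (proper-⊆ E₁⊆E P) (misses₁ u α u-misses-α) v-misses-α₁) α'
      (misses-addEdge-end E₁ col u v α v α' α'≢α (misses₁ v α' v-misses-α'))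
      (misses-addEdge-outside E₁ col u v α w α' w≢u w≢v w-misses-α'₁)

    kempe : ∀ β → Misses E col v β → β ≢ α → α' ≢ β → Misses E col u α' → Extensible E u v
    kempe β v-misses-β β≢α α'≢β u-misses-α' = switched
      where
      open Kempe E col P E-sym α' β α'≢β
      open Component v v-misses-β
      switched : Extensible E u v
      switched with K u in Ku
      ... | false = recolour (switch K) u v α' ,
                    proper-addEdge u v α' u≢v (proper-switch K K-closed)
                      (switch-misses-outside K u α' Ku u-misses-α') (switch-misses-a K v K-v v-misses-β)
      ... | true with K w in Kw
      ...   | true = ⊥-elim (one-end u w (w≢u ∘ sym) u≢v w≢v u-misses-α' w-misses-α' Ku Kw)
      ...   | false = readd-vw
        (proper-addEdge u v α u≢v (proper-⊆ E₁⊆E (proper-switch K K-closed)) u-misses-α-sw v-misses-α-sw) α'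
        (misses-addEdge-end E₁ (switch K) u v α v α' α'≢α
          (λ y e c → v-misses-β y (E₁⊆E v y e) (switch-a K v y K-v c)))
        (misses-addEdge-outside E₁ (switch K) u v α w α' w≢u w≢v
          (λ y e c → w-misses-α'₁ y e (trans (sym (switch-outside K w y Kw)) c)))
        where
        α≢α' : α ≢ α'
        α≢α' = α'≢α ∘ sym
        α≢β : α ≢ β
        α≢β = β≢α ∘ sym
        u-misses-α-sw : Misses E₁ (switch K) u α
        u-misses-α-sw y e c = u-misses-α y (E₁⊆E u y e) (switch-other K u y α α≢α' α≢β c)
        v-misses-α-sw : Misses E₁ (switch K) v α
        v-misses-α-sw y e c = v-misses-α₁ y e (switch-other K v y α α≢α' α≢β c)

    extensible : Extensible E u v
    extensible with present E col v α' in α'-at-v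
    ... | false = α'-free-at-v (present-false E col v α' α'-at-v)
    ... | true with present E col u α' in α'-at-u | missing E col v (<-≤-trans (s≤s deg-v) d<k)
    ...   | true | _ = ⊥-elim (not-present-at-both α' α'-at-u α'-at-v)
    ...   | false | (β , v-misses-β) = kempe β v-misses-β β≢α α'≢β (present-false E col u α' α'-at-u)
      where
      β≢α : β ≢ α
      β≢α β≡α = v-misses-β w Evw (trans cvw (sym β≡α))
      α'≢β : α' ≢ β
      α'≢β α'≡β = t≢f (trans (sym α'-at-v) (trans (cong (present E col v) α'≡β) (misses⇒absent E col v β v-misses-β)))

  extend : ∀ E col → Proper E col → (∀ x y → E x y ≡ E y x) → (∀ x → E x x ≡ false) →
    (∀ x → cnt (E x) ≤ suc d) → ∀ u v → u ≢ v → cnt (E u) ≤ d → cnt (E v) ≤ d → Extensible E u v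
  extend E col P E-sym E-irr deg u v u≢v deg-u deg-v
    with search (λ γ → not (present E col u γ) ∧ not (present E col v γ))
  ... | inj₁ (γ , e) = let (γ∉u , γ∉v) = ∧-true e in
    recolour col u v γ ,
    proper-addEdge u v γ u≢v P (present-false E col u γ (not-true γ∉u)) (present-false E col v γ (not-true γ∉v))
  ... | inj₂ none = NoCommonMissing.extensible E col P E-sym u v u≢v deg-u deg-v covers
                      α u-misses-α w Evw cvw w≢u w≢v α' α'≢α w-misses-α'₁
    where
    covers : ∀ γ → present E col u γ ≡ false → present E col v γ ≡ true
    covers γ γ∉u = not-false (subst (λ b → not b ∧ not (present E col v γ) ≡ false) γ∉u (none γ))
    u-free : ∃ λ α → Misses E col u α
    u-free = missing E col u (<-≤-trans (s≤s deg-u) d<k)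
    α : Fin k
    α = proj₁ u-free
    u-misses-α : Misses E col u α
    u-misses-α = proj₂ u-free
    α-edge-at-v : ∃ λ w → E v w ≡ true × col v w ≡ α
    α-edge-at-v = present-true E col v α (covers α (misses⇒absent E col u α u-misses-α))
    w : Fin n
    w = proj₁ α-edge-at-v
    Evw : E v w ≡ true
    Evw = proj₁ (proj₂ α-edge-at-v)
    cvw : col v w ≡ α
    cvw = proj₂ (proj₂ α-edge-at-v)
    Ewv : E w v ≡ true
    Ewv = trans (E-sym w v) Evw
    w≢u : w ≢ u
    w≢u w≡u = u-misses-α v (subst (λ z → E z v ≡ true) w≡u Ewv)
                (subst (λ z → col z v ≡ α) w≡u (trans (sym (col-sym P v w Evw)) cvw))
    w≢v : w ≢ v
    w≢v w≡v = t≢f (trans (sym (subst (λ z → E v z ≡ true) w≡v Evw)) (E-irr v))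
    -- w loses the edge wv in E - vw, so it has degree ≤ d there
    deg-w₁ : cnt (delEdge E v w w) < suc d
    deg-w₁ = <-≤-trans (cnt-mono-< (delEdge-⊆ E v w w) v wv-deleted Ewv) (deg w)
      where wv-deleted : delEdge E v w w v ≡ false
            wv-deleted rewrite isPair-vu v w | Ewv = refl
    w-free : ∃ λ α' → α' ≢ α × Misses (delEdge E v w) col w α'
    w-free = missing-≢ (delEdge E v w) col w α (≤-trans (s≤s deg-w₁) d+2≤k)
    α' : Fin k
    α' = proj₁ w-free
    α'≢α : α' ≢ α
    α'≢α = proj₁ (proj₂ w-free)
    w-misses-α'₁ : Misses (delEdge E v w) col w α'
    w-misses-α'₁ = proj₂ (proj₂ w-free)

-- Induction on
-- the degree sum: delete an edge uv, colour the rest, and add uv back with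
-- OneEdgeExtension (u and v have degree ≤ d after the deletion).

module EdgeColouringTheorem {n k d : ℕ} (2d≤k : d + d ≤ k) (d+2≤k : suc (suc d) ≤ k) where

  open EdgeColouring {n} {k}
  open OneEdgeExtension {n} {k} {d} 2d≤k d+2≤k using (extend)

  edgeless-proper : ∀ (E : EdgeRel) → (∀ x → anyF (E x) ≡ false) → ∃ λ col → Proper E col
  edgeless-proper E none = (λ _ _ → colour₀) , record
    { col-sym = λ x y e → ⊥-elim (noEdge x y e)
    ; col-inj = λ x y z e _ _ → ⊥-elim (noEdge x y e) }
    where
    colour₀ : Fin k
    colour₀ = fromℕ< (≤-trans (s≤s z≤n) d+2≤k)
    noEdge : ∀ x y → E x y ≡ true → ⊥
    noEdge x y e = t≢f (trans (sym e) (anyF-false _ (none x) y))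

  colour-by-degreeSum : ∀ m (E : EdgeRel) → (∀ x y → E x y ≡ E y x) → (∀ x → E x x ≡ false) →
    (∀ x → cnt (E x) ≤ suc d) → ∑ (λ x → cnt (E x)) ≤ m → ∃ λ col → Proper E col
  colour-by-degreeSum m E E-sym E-irr deg total with search (λ x → anyF (E x))
  ... | inj₂ none = edgeless-proper E none
  ... | inj₁ (u , u-has-edge) = colour-with-edge m total
    where
    v : Fin n
    v = proj₁ (anyF-true (E u) u-has-edge)
    Euv : E u v ≡ true
    Euv = proj₂ (anyF-true (E u) u-has-edge)
    Evu : E v u ≡ true
    Evu = trans (E-sym v u) Euv
    u≢v : u ≢ v
    u≢v u≡v = t≢f (trans (sym (subst (λ z → E u z ≡ true) (sym u≡v) Euv)) (E-irr u))
    E' : EdgeRel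
    E' = delEdge E u v
    E'⊆E : ∀ x y → E' x y ≡ true → E x y ≡ true
    E'⊆E = delEdge-⊆ E u v
    E'-sym : ∀ x y → E' x y ≡ E' y x
    E'-sym x y = cong₂ (λ e p → e ∧ not p) (E-sym x y) (isPair-sym u v x y)
    E'-irr : ∀ x → E' x x ≡ false
    E'-irr x rewrite E-irr x = refl
    E'uv : E' u v ≡ false
    E'uv rewrite isPair-uv u v | Euv = refl
    E'vu : E' v u ≡ false
    E'vu rewrite isPair-vu u v | Evu = refl
    deg-u : cnt (E' u) < suc d
    deg-u = <-≤-trans (cnt-mono-< (E'⊆E u) v E'uv Euv) (deg u)
    deg-v : cnt (E' v) < suc d
    deg-v = <-≤-trans (cnt-mono-< (E'⊆E v) u E'vu Evu) (deg v)
    smaller : ∑ (λ x → cnt (E' x)) < ∑ (λ x → cnt (E x))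
    smaller = ∑-mono-< (λ x → cnt-mono (E'⊆E x)) u (cnt-mono-< (E'⊆E u) v E'uv Euv)
    E⊆E'+uv : ∀ x y → E x y ≡ true → addEdge E' u v x y ≡ true
    E⊆E'+uv x y e with isPair u v x y
    ... | true = ∨-zeroʳ (E x y ∧ false)
    ... | false rewrite e = refl
    colour-with-edge : ∀ m → ∑ (λ x → cnt (E x)) ≤ m → ∃ λ col → Proper E col
    colour-with-edge zero total = ⊥-elim (<-irrefl refl (<-≤-trans (≤-<-trans z≤n smaller) total))
    colour-with-edge (suc m) total =
      let (col , P) = colour-by-degreeSum m E' E'-sym E'-irr (λ x → ≤-trans (cnt-mono (E'⊆E x)) (deg x))
                        (≤-pred (<-≤-trans smaller total))
          (col' , P') = extend E' col P E'-sym E'-irr (λ x → ≤-trans (cnt-mono (E'⊆E x)) (deg x))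
                          u v u≢v (≤-pred deg-u) (≤-pred deg-v)
      in col' , proper-⊆ E⊆E'+uv P'

  edgeColourable : ∀ (E : EdgeRel) → (∀ x y → E x y ≡ E y x) → (∀ x → E x x ≡ false) →
    (∀ x → cnt (E x) ≤ suc d) → ∃ λ col → Proper E col
  edgeColourable E E-sym E-irr deg = colour-by-degreeSum _ E E-sym E-irr deg ≤-refl

-- Counting weak edges
--
-- It is half the number of ordered pairs (x,y) forming a weak edge,
-- a quantity that is easier to compare between G and G - A.

sum-tabulate : ∀ {A : Set} {n} (g : Fin n → A) (f : A → ℕ) → sum (map f (tabulate g)) ≡ ∑ (f ∘ g)
sum-tabulate {n = zero} g f = refl
sum-tabulate {n = suc n} g f = cong (f (g zero) +_) (sum-tabulate (g ∘ suc) f)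

sum-concatMap : ∀ {A : Set} {n} (g : Fin n → A) (h : A → List ℕ) →
  sum (concatMap h (tabulate g)) ≡ ∑ (sum ∘ h ∘ g)
sum-concatMap {n = zero} g h = refl
sum-concatMap {n = suc n} g h =
  trans (sum-++ (h (g zero)) (concatMap h (tabulate (g ∘ suc)))) (cong (sum (h (g zero)) +_) (sum-concatMap (g ∘ suc) h))

weakEdge : ∀ {n c} → Graph n → Labeling n c → Fin n → Fin n → Bool
weakEdge G L x y = adj G x y ∧ isWeak (L x y)

weakPairs : ∀ {n c} → Graph n → Labeling n c → ℕ
weakPairs G L = ∑ (λ x → ∑ (λ y → boolℕ (weakEdge G L x y)))

weakEdge-sym : ∀ {n c} (G : Graph n) (L : Labeling n c) → IsLabelingOf G L → ∀ x y → weakEdge G L x y ≡ weakEdge G L y x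
weakEdge-sym G L lab x y with adj G x y in e
... | true rewrite lab x y e | trans (sym (adj-sym G x y)) e = refl
... | false rewrite trans (sym (adj-sym G x y)) e = refl

<ᵇ-true : ∀ {a b} → a < b → (a <ᵇ b) ≡ true
<ᵇ-true a<b = Equivalence.to T-≡ (<⇒<ᵇ a<b)

<ᵇ-false : ∀ a b → ¬ (a < b) → (a <ᵇ b) ≡ false
<ᵇ-false a b a≮b with a <ᵇ b in e
... | false = refl
... | true = ⊥-elim (a≮b (<ᵇ⇒< a b (Equivalence.from T-≡ e)))

split-by-order : ∀ (a b : ℕ) (w : Bool) → a ≢ b → boolℕ w ≡ boolℕ ((a <ᵇ b) ∧ w) + boolℕ ((b <ᵇ a) ∧ w)
split-by-order a b w a≢b with <-cmp a b
... | tri< a<b _ b≮a rewrite <ᵇ-true a<b | <ᵇ-false b a b≮a = sym (+-identityʳ _)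
... | tri> a≮b _ b<a rewrite <ᵇ-true b<a | <ᵇ-false a b a≮b = refl
... | tri≈ _ a≡b _ = ⊥-elim (a≢b a≡b)

weakCount-double : ∀ {n c} (G : Graph n) (L : Labeling n c) → IsLabelingOf G L →
  weakCount G L + weakCount G L ≡ weakPairs G L
weakCount-double {n} G L lab = sym (begin
    weakPairs G L
  ≡⟨ sum-cong-≗ {n} (λ x → sum-cong-≗ {n} (λ y → both-orders x y)) ⟩
    ∑ (λ x → ∑ (λ y → below x y + below y x))
  ≡⟨ sum-cong-≗ {n} (λ x → ∑-distrib-+ (below x) (λ y → below y x)) ⟩
    ∑ (λ x → ∑ (below x) + ∑ (λ y → below y x))
  ≡⟨ ∑-distrib-+ (λ x → ∑ (below x)) (λ x → ∑ (λ y → below y x)) ⟩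
    ∑ (λ x → ∑ (below x)) + ∑ (λ x → ∑ (λ y → below y x))
  ≡⟨ cong (∑ (λ x → ∑ (below x)) +_) (∑-comm (λ x y → below y x)) ⟩
    ∑ (λ x → ∑ (below x)) + ∑ (λ y → ∑ (below y))
  ≡⟨ sym (cong₂ _+_ weakCount-as-∑ weakCount-as-∑) ⟩
    weakCount G L + weakCount G L ∎)
  where
  open ≡-Reasoning
  below : Fin n → Fin n → ℕ
  below u v = boolℕ ((toℕ u <ᵇ toℕ v) ∧ weakEdge G L u v)
  weakCount-as-∑ : weakCount G L ≡ ∑ (λ u → ∑ (below u))
  weakCount-as-∑ = trans (sum-concatMap (λ i → i) (λ u → map (below u) (allFin n)))
                         (sum-cong-≗ {n} (λ u → sum-tabulate (λ i → i) (below u)))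
  both-orders : ∀ x y → boolℕ (weakEdge G L x y) ≡ below x y + below y x
  both-orders x y with weakEdge G L x y in e
  ... | false rewrite trans (sym (weakEdge-sym G L lab x y)) e
                    | ∧-zeroʳ (toℕ x <ᵇ toℕ y) | ∧-zeroʳ (toℕ y <ᵇ toℕ x) = refl
  ... | true rewrite trans (sym (weakEdge-sym G L lab x y)) e =
    split-by-order (toℕ x) (toℕ y) true (λ eq → x≢y (toℕ-injective eq))
    where x≢y : x ≢ y
          x≢y x≡y = t≢f (trans (sym (subst (λ z → adj G x z ≡ true) (sym x≡y) (proj₁ (∧-true e)))) (adj-irr G x))

weakCount-mono : ∀ {n m c} (G : Graph n) (L : Labeling n c) (H : Graph m) (L' : Labeling m c) →
  IsLabelingOf G L → IsLabelingOf H L' → weakPairs G L ≤ weakPairs H L' → weakCount G L ≤ weakCount H L'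
weakCount-mono G L H L' lab lab' pairs≤ = half (begin
    weakCount G L + weakCount G L   ≡⟨ weakCount-double G L lab ⟩
    weakPairs G L                   ≤⟨ pairs≤ ⟩
    weakPairs H L'                  ≡⟨ sym (weakCount-double H L' lab') ⟩
    weakCount H L' + weakCount H L' ∎)
  where
  open ≤-Reasoning
  half : ∀ {a b} → a + a ≤ b + b → a ≤ b
  half {a} {b} 2a≤2b with ≤-<-connex a b
  ... | inj₁ a≤b = a≤b
  ... | inj₂ b<a = ⊥-elim (<-irrefl refl (≤-<-trans 2a≤2b (+-mono-< b<a b<a)))

∑-fibres : ∀ {m n} (ι : Fin m → Fin n) (h : Fin n → ℕ) →
  ∑ (h ∘ ι) ≡ ∑ (λ x → h x * cnt (λ i → eqF (ι i) x))
∑-fibres {m} {n} ι h = begin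
    ∑ (h ∘ ι)
  ≡⟨ sum-cong-≗ {m} (λ i → sym (∑-indicator (ι i) h)) ⟩
    ∑ (λ i → ∑ (λ x → boolℕ (eqF (ι i) x) * h x))
  ≡⟨ ∑-comm (λ i x → boolℕ (eqF (ι i) x) * h x) ⟩
    ∑ (λ x → ∑ (λ i → boolℕ (eqF (ι i) x) * h x))
  ≡⟨ sum-cong-≗ {n} (λ x → trans (sum-cong-≗ {m} (λ i → *-comm (boolℕ (eqF (ι i) x)) (h x)))
                                  (sym (*-distribˡ-sum (h x) (λ i → boolℕ (eqF (ι i) x))))) ⟩
    ∑ (λ x → h x * cnt (λ i → eqF (ι i) x)) ∎
  where open ≡-Reasoning

∑-injective-≤ : ∀ {m n} (ι : Fin m → Fin n) → (∀ i j → ι i ≡ ι j → i ≡ j) → (h : Fin n → ℕ) →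
  ∑ (h ∘ ι) ≤ ∑ h
∑-injective-≤ {m} {n} ι ι-inj h = begin
    ∑ (h ∘ ι)                                 ≡⟨ ∑-fibres ι h ⟩
    ∑ (λ x → h x * cnt (λ i → eqF (ι i) x))   ≤⟨ ∑-mono {n} (λ x → *-monoʳ-≤ (h x) (fibre≤1 x)) ⟩
    ∑ (λ x → h x * 1)                         ≡⟨ sum-cong-≗ {n} (λ x → *-identityʳ (h x)) ⟩
    ∑ h                                       ∎
  where
  open ≤-Reasoning
  fibre≤1 : ∀ x → cnt (λ i → eqF (ι i) x) ≤ 1
  fibre≤1 x = cnt-unique (λ i → eqF (ι i) x) (λ i j p q → ι-inj i j (trans (eqF-true p) (sym (eqF-true q))))

∑-≤-onto-support : ∀ {m n} (ι : Fin m → Fin n) (h : Fin n → ℕ) →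
  (∀ x → h x ≡ 0 ⊎ ∃ λ i → ι i ≡ x) → ∑ h ≤ ∑ (h ∘ ι)
∑-≤-onto-support {m} {n} ι h support = begin
    ∑ h                                       ≡⟨ sum-cong-≗ {n} (λ x → *-identityʳ (h x)) ⟨
    ∑ (λ x → h x * 1)                         ≤⟨ ∑-mono {n} term ⟩
    ∑ (λ x → h x * cnt (λ i → eqF (ι i) x))   ≡⟨ ∑-fibres ι h ⟨
    ∑ (h ∘ ι)                                 ∎
  where
  open ≤-Reasoning
  term : ∀ x → h x * 1 ≤ h x * cnt (λ i → eqF (ι i) x)
  term x with support x
  ... | inj₁ hx≡0 rewrite hx≡0 = z≤n
  ... | inj₂ (i , ιi≡x) = *-monoʳ-≤ (h x) (cnt-pos i (subst (λ y → eqF (ι i) y ≡ true) ιi≡x (eqF-refl (ι i))))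

module _ {n m : ℕ} {G : Graph n} {A : Fin n → Bool} {H : Graph m} (del : IsDeletionOf G A H) where

  open IsDeletionOf del

  restriction-yes : ∀ {c k} → YesInstance G c k → YesInstance H c k
  restriction-yes {c} {k} (L , lab , stc , weak≤k) = L' , lab' , stc' , ≤-trans fewerWeak weak≤k
    where
    L' : Labeling m c
    L' i j = L (ι i) (ι j)
    lab' : IsLabelingOf H L'
    lab' i j e = lab (ι i) (ι j) (trans (sym (ι-adj i j)) e)
    stc' : IsSTC H L'
    stc' u v w γ u≢w Euv Evw Luv Lvw = trans (ι-adj u w)
      (stc (ι u) (ι v) (ι w) γ (u≢w ∘ ι-inj u w) (trans (sym (ι-adj u v)) Euv) (trans (sym (ι-adj v w)) Evw) Luv Lvw)
    weakG : Fin n → Fin n → ℕ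
    weakG x y = boolℕ (weakEdge G L x y)
    fewerPairs : weakPairs H L' ≤ weakPairs G L
    fewerPairs = begin
        weakPairs H L'
      ≡⟨ sum-cong-≗ {m} (λ i → sum-cong-≗ {m} (λ j → cong (λ e → boolℕ (e ∧ isWeak (L' i j))) (ι-adj i j))) ⟩
        ∑ (λ i → ∑ (λ j → weakG (ι i) (ι j)))
      ≤⟨ ∑-mono {m} (λ i → ∑-injective-≤ ι ι-inj (weakG (ι i))) ⟩
        ∑ (λ i → ∑ (weakG (ι i)))
      ≤⟨ ∑-injective-≤ ι ι-inj (λ x → ∑ (weakG x)) ⟩
        weakPairs G L ∎
      where open ≤-Reasoning
    fewerWeak : weakCount H L' ≤ weakCount G L
    fewerWeak = weakCount-mono H L' G L lab' lab fewerPairs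

-- The edges of G starting in a vertex set A; if A is closed under
-- adjacency, this is the symmetric edge relation of G[A]

edgesIn : ∀ {n} → Graph n → (Fin n → Bool) → Fin n → Fin n → Bool
edgesIn G A x y = A x ∧ adj G x y

module _ {n : ℕ} (G : Graph n) (A : Fin n → Bool)
  (A-closed : ∀ a x → A a ≡ true → adj G a x ≡ true → A x ≡ true) where

  edgesIn-sym : ∀ x y → edgesIn G A x y ≡ edgesIn G A y x
  edgesIn-sym x y with adj G x y in Exy
  ... | false rewrite trans (adj-sym G y x) Exy = trans (∧-zeroʳ (A x)) (sym (∧-zeroʳ (A y)))
  ... | true rewrite trans (adj-sym G y x) Exy with bool-cases (A x) | bool-cases (A y)
  ...   | inj₁ Ax | _ rewrite Ax | A-closed x y Ax Exy = refl
  ...   | inj₂ Ax | inj₂ Ay rewrite Ax | Ay = refl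
  ...   | inj₂ Ax | inj₁ Ay = ⊥-elim (t≢f (trans (sym (A-closed y x Ay (trans (adj-sym G y x) Exy))) Ax))

edgesIn-irr : ∀ {n} (G : Graph n) (A : Fin n → Bool) → ∀ x → edgesIn G A x x ≡ false
edgesIn-irr G A x rewrite adj-irr G x = ∧-zeroʳ (A x)

-- If every neighbour of a vertex of A lies in A and the edges of G[A] have
-- a proper edge colouring, label those edges strongly by their colour.
-- A proper colouring never puts one colour on two edges at a vertex, so
-- no STC-violation arises inside A, and no weak edge is added.

module _ {n m c : ℕ} {G : Graph n} {A : Fin n → Bool} {H : Graph m} (del : IsDeletionOf G A H)
  (A-closed : ∀ a x → A a ≡ true → adj G a x ≡ true → A x ≡ true) where

  open IsDeletionOf del
  open EdgeColouring {n} {c} using (Proper; col-sym; col-inj)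

  A-closed' : ∀ x a → adj G x a ≡ true → A a ≡ true → A x ≡ true
  A-closed' x a e Aa = A-closed a x Aa (trans (adj-sym G a x) e)

  choose : (x : Fin n) (b : Bool) → A x ≡ b → Maybe (Fin m)
  choose x true _ = nothing
  choose x false Ax = just (proj₁ (ι-onto x Ax))

  preimage : Fin n → Maybe (Fin m)
  preimage x = choose x (A x) refl

  preimage-outside : ∀ x → A x ≡ false → ∃ λ i → preimage x ≡ just i × ι i ≡ x
  preimage-outside x Ax = chosen (A x) refl Ax
    where chosen : ∀ b (e : A x ≡ b) → b ≡ false → ∃ λ i → choose x b e ≡ just i × ι i ≡ x
          chosen false e _ = proj₁ (ι-onto x e) , refl , proj₂ (ι-onto x e)

  preimage-inside : ∀ x → A x ≡ true → preimage x ≡ nothing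
  preimage-inside x Ax = chosen (A x) refl Ax
    where chosen : ∀ b (e : A x ≡ b) → b ≡ true → choose x b e ≡ nothing
          chosen true e _ = refl

  preimage-ι : ∀ i → preimage (ι i) ≡ just i
  preimage-ι i = let (j , e , ιj≡ιi) = preimage-outside (ι i) (ι-out i) in trans e (cong just (ι-inj j i ιj≡ιi))

  strong-injective : ∀ {γ δ : Fin c} → strong γ ≡ strong δ → γ ≡ δ
  strong-injective refl = refl

  module Extended (col : Fin n → Fin n → Fin c) (P : Proper (edgesIn G A) col) (L : Labeling m c) where

    combine : Maybe (Fin m) → Maybe (Fin m) → Fin n → Fin n → Label c
    combine (just i) (just j) x y = L i j
    combine _ _ x y = strong (col x y)
    L' : Labeling n c
    L' x y = combine (preimage x) (preimage y) x y

    L'-inside : ∀ x y → A x ≡ true → L' x y ≡ strong (col x y)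
    L'-inside x y Ax rewrite preimage-inside x Ax = refl
    L'-inside' : ∀ x y → A y ≡ true → L' x y ≡ strong (col x y)
    L'-inside' x y Ay rewrite preimage-inside y Ay with preimage x
    ... | just i = refl
    ... | nothing = refl
    L'-ι : ∀ i j → L' (ι i) (ι j) ≡ L i j
    L'-ι i j rewrite preimage-ι i | preimage-ι j = refl

    lab' : IsLabelingOf H L → IsLabelingOf G L'
    lab' lab x y e with bool-cases (A x)
    ... | inj₁ Ax rewrite L'-inside x y Ax | L'-inside y x (A-closed x y Ax e) = cong strong (col-sym P x y (∧-intro Ax e))
    ... | inj₂ Ax with bool-cases (A y)
    ...   | inj₁ Ay = ⊥-elim (t≢f (trans (sym (A-closed' x y e Ay)) Ax))
    ...   | inj₂ Ay with preimage-outside x Ax | preimage-outside y Ay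
    ...     | (i , _ , refl) | (j , _ , refl) rewrite L'-ι i j | L'-ι j i = lab i j (trans (ι-adj i j) e)

    -- a violating path through a vertex of A would give two edges of one colour at it
    stc' : IsSTC H L → IsSTC G L'
    stc' stc u v w γ u≢w Euv Evw Luv Lvw with bool-cases (A v)
    ... | inj₁ Av = ⊥-elim (u≢w (col-inj P v u w Evu∈A Evw∈A sameColour))
      where
      Au : A u ≡ true
      Au = A-closed' u v Euv Av
      Evu∈A : edgesIn G A v u ≡ true
      Evu∈A = ∧-intro Av (trans (adj-sym G v u) Euv)
      Evw∈A : edgesIn G A v w ≡ true
      Evw∈A = ∧-intro Av Evw
      sameColour : col v u ≡ col v w
      sameColour = trans (sym (col-sym P u v (∧-intro Au Euv)))
        (trans (strong-injective (trans (sym (L'-inside u v Au)) Luv)) (sym (strong-injective (trans (sym (L'-inside v w Av)) Lvw))))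
    ... | inj₂ Av with bool-cases (A u) | bool-cases (A w)
    ...   | inj₁ Au | _ = ⊥-elim (t≢f (trans (sym (A-closed u v Au Euv)) Av))
    ...   | inj₂ _ | inj₁ Aw = ⊥-elim (t≢f (trans (sym (A-closed' v w Evw Aw)) Av))
    ...   | inj₂ Au | inj₂ Aw with preimage-outside u Au | preimage-outside v Av | preimage-outside w Aw
    ...     | (i , _ , refl) | (j , _ , refl) | (l , _ , refl) rewrite L'-ι i j | L'-ι j l =
      trans (sym (ι-adj i l)) (stc i j l γ (u≢w ∘ cong ι) (trans (ι-adj i j) Euv) (trans (ι-adj j l) Evw) Luv Lvw)

    weakG : Fin n → Fin n → ℕ
    weakG x y = boolℕ (weakEdge G L' x y)
    -- edges meeting A are strong, so weak pairs avoid A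
    weak-row : ∀ x y → A x ≡ true → weakG x y ≡ 0
    weak-row x y Ax rewrite L'-inside x y Ax = cong boolℕ (∧-zeroʳ (adj G x y))
    weak-column : ∀ x y → A y ≡ true → weakG x y ≡ 0
    weak-column x y Ay rewrite L'-inside' x y Ay = cong boolℕ (∧-zeroʳ (adj G x y))
    outside-image : ∀ {h : Fin n → ℕ} → (∀ x → A x ≡ true → h x ≡ 0) → ∀ x → h x ≡ 0 ⊎ ∃ λ i → ι i ≡ x
    outside-image vanish x with bool-cases (A x)
    ... | inj₁ Ax = inj₁ (vanish x Ax)
    ... | inj₂ Ax = inj₂ (ι-onto x Ax)
    fewerPairs : weakPairs G L' ≤ weakPairs H L
    fewerPairs = begin
        weakPairs G L'
      ≤⟨ ∑-≤-onto-support ι (λ x → ∑ (weakG x))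
           (outside-image (λ x Ax → trans (sum-cong-≗ {n} (λ y → weak-row x y Ax)) (sum-replicate-zero n))) ⟩
        ∑ (λ i → ∑ (weakG (ι i)))
      ≤⟨ ∑-mono {m} (λ i → ∑-≤-onto-support ι (weakG (ι i)) (outside-image (weak-column (ι i)))) ⟩
        ∑ (λ i → ∑ (λ j → weakG (ι i) (ι j)))
      ≡⟨ sum-cong-≗ {m} (λ i → sum-cong-≗ {m} (λ j → cong₂ (λ e l → boolℕ (e ∧ isWeak l)) (sym (ι-adj i j)) (L'-ι i j))) ⟩
        weakPairs H L ∎
      where open ≤-Reasoning

  extension-yes : ∀ {k} (col : Fin n → Fin n → Fin c) → Proper (edgesIn G A) col → YesInstance H c k → YesInstance G c k
  extension-yes col P (L , lab , stc , weak≤k) =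
    L' , lab' lab , stc' stc , ≤-trans (weakCount-mono G L' H L (lab' lab) lab fewerPairs) weak≤k
    where open Extended col P L

-- for even c ≥ 4, d = c/2 satisfies the hypotheses of the colouring theorem
even-half-bounds : ∀ c → 4 ≤ c → c % 2 ≡ 0 → (c / 2 + c / 2 ≤ c) × (suc (suc (c / 2)) ≤ c)
even-half-bounds c 4≤c even = ≤-reflexive (sym c≡d+d) , d+2≤c
  where
  d : ℕ
  d = c / 2
  c≡d+d : c ≡ d + d
  c≡d+d = begin
    c                   ≡⟨ m≡m%n+[m/n]*n c 2 ⟩
    c % 2 + d * 2       ≡⟨ cong (_+ d * 2) even ⟩
    d * 2               ≡⟨ *-comm d 2 ⟩
    d + (d + 0)         ≡⟨ cong (d +_) (+-identityʳ d) ⟩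
    d + d               ∎
    where open ≡-Reasoning
  d+2≤c : suc (suc d) ≤ c
  d+2≤c with d | c≡d+d
  ... | zero | refl = ⊥-elim (<-irrefl refl (<-≤-trans (s≤s z≤n) 4≤c))
  ... | suc zero | refl = ⊥-elim (<-irrefl refl (<-≤-trans (s≤s (s≤s (s≤s z≤n))) 4≤c))
  ... | suc (suc e) | refl = s≤s (s≤s (m≤n+m (suc (suc e)) e))

module _ {n c : ℕ} {G : Graph n} (Δ : Deletion G c) {A : Fin n → Bool}
  (component : IsPeripheryComponent Δ A) (noClose : NoCloseVertices Δ A) where

  -- a neighbour of a vertex of A is not in the core, hence lies in A
  component-closed : ∀ a x → A a ≡ true → adj G a x ≡ true → A x ≡ true
  component-closed a x Aa e = proj₂ (proj₂ (proj₂ component)) a x Aa (noClose a x Aa e) e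

  -- no edge at a vertex of A belongs to D, so its degree is ≤ c/2 + 1
  component-degree : ∀ x → cnt (edgesIn G A x) ≤ suc (c / 2)
  component-degree x with bool-cases (A x)
  ... | inj₂ Ax = ≤-trans (≤-reflexive (cnt-none (edgesIn G A x) (λ y → cong (_∧ adj G x y) Ax))) z≤n
  ... | inj₁ Ax = begin
      cnt (edgesIn G A x)
    ≡⟨ cnt-cong (λ y → trans (cong (_∧ adj G x y) Ax) (sym (outside-D y))) ⟩
      cnt (λ y → adj G x y ∧ not (D Δ x y))
    ≡⟨ sum-tabulate (λ i → i) (λ y → boolℕ (adj G x y ∧ not (D Δ x y))) ⟨
      countFin (λ y → adj G x y ∧ not (D Δ x y))
    ≤⟨ maxDeg Δ x ⟩
      c / 2 + 1
    ≡⟨ +-comm (c / 2) 1 ⟩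
      suc (c / 2) ∎
    where
    open ≤-Reasoning
    outside-D : ∀ y → adj G x y ∧ not (D Δ x y) ≡ adj G x y
    outside-D y with D Δ x y in e
    ... | false = ∧-identityʳ (adj G x y)
    ... | true = ⊥-elim (proj₁ (proj₂ component) x Ax (y , e))

proposition20 : ∀ {n m : ℕ} (G : Graph n) (c k : ℕ) →
    4 ≤ c → c % 2 ≡ 0 →
    (Δ : Deletion G c) (A : Fin n → Bool) →
    IsPeripheryComponent Δ A → NoCloseVertices Δ A →
    (H : Graph m) → IsDeletionOf G A H →
    YesInstance G c k ⇔ YesInstance H c k
proposition20 {n} G c k 4≤c even Δ A component noClose H del =
  mk⇔ (restriction-yes del) (extension-yes del closed (proj₁ colouring) (proj₂ colouring))
  where
  closed : ∀ a x → A a ≡ true → adj G a x ≡ true → A x ≡ true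
  closed = component-closed Δ component noClose
  -- G[A] has maximum degree ≤ c/2 + 1, so it is properly c-edge-colourable
  colouring : ∃ λ col → EdgeColouring.Proper {n} {c} (edgesIn G A) col
  colouring = EdgeColouringTheorem.edgeColourable
    (proj₁ (even-half-bounds c 4≤c even)) (proj₂ (even-half-bounds c 4≤c even))
    (edgesIn G A) (edgesIn-sym G A closed) (edgesIn-irr G A) (component-degree Δ component noClose)
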